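{- Let $m,n>1$ be integers. If three points $a=(a_x,a_y)$, $b=(b_x,b_y)$, $c=(c_x,c_y)$ of $T_{m\times n}$ lie on a common line on $T_{m\times n}$, then \[D(a,b,c)=\begin{vmatrix}1&1&1\\ a_x&b_x&c_x\\ a_y&b_y&c_y\end{vmatrix}\equiv 0 \pmod{\gcd(m,n)},\] where the coordinates are regarded as integers.
   Context: For integers $m,n>1$, the discrete torus is $T_{m\times n}=\{0,\dots,m-1\}\times\{0,\dots,n-1\}$, with projection $\pi_{m,n}:\mathbb Z\times\mathbb Z\to T_{m\times n}$, $\pi_{m,n}(a,b)=(a \bmod m,\ b\bmod n)$ (least non-negative remainders). A line in $\mathbb Z\times\mathbb Z$ is a set $\{(a+uk,b+vk):k\in\mathbb Z\}$ with $a,b,u,v\in\mathbb Z$ and $\gcd(u,v)=1$. A line on $T_{m\times n}$ is the image under $\pi_{m,n}$ of a line in $\mathbb Z\times\mathbb Z$. -}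

module Defs where

open import Data.Nat as ℕ using (ℕ; NonZero; _<_)
open import Data.Nat.GCD using (gcd)
open import Data.Integer as ℤ using (ℤ; +_; _%ℕ_; ∣_∣)
open import Data.Product using (_×_; _,_; Σ; ∃)
open import Relation.Binary.PropositionalEquality using (_≡_)

Point : Set
Point = ℕ × ℕ

InTorus : ℕ → ℕ → Point → Set
InTorus m n (x , y) = (x < m) × (y < n)

π : (m n : ℕ) .{{_ : NonZero m}} .{{_ : NonZero n}} → ℤ × ℤ → Point
π m n (a , b) = (a %ℕ m , b %ℕ n)

record Line : Set where
  constructor line
  field
    a b u v : ℤ
    primitive-dir : gcd ∣ u ∣ ∣ v ∣ ≡ 1

pointAt : Line → ℤ → ℤ × ℤ
pointAt L k = (Line.a L ℤ.+ Line.u L ℤ.* k , Line.b L ℤ.+ Line.v L ℤ.* k)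

OnTorusLine : (m n : ℕ) .{{_ : NonZero m}} .{{_ : NonZero n}} → Line → Point → Set
OnTorusLine m n L p = ∃ λ (k : ℤ) → π m n (pointAt L k) ≡ p

D : Point → Point → Point → ℤ
D (ax , ay) (bx , by) (cx , cy) =
  ((+ bx) ℤ.* (+ cy) ℤ.- (+ cx) ℤ.* (+ by))
  ℤ.- ((+ ax) ℤ.* (+ cy) ℤ.- (+ cx) ℤ.* (+ ay))
  ℤ.+ ((+ ax) ℤ.* (+ by) ℤ.- (+ bx) ℤ.* (+ ay))

-- The determinant is a polynomial in the coordinates, so reducing the coordinates modulo
-- m and n changes it only by a multiple of gcd(m, n). Each point of the torus is such a
-- reduction of a point of one line of ℤ × ℤ, and three collinear points of ℤ × ℤ have
-- determinant exactly 0.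
module Submission where

open import Defs
open import Data.Nat using (ℕ; NonZero; _<_)
open import Data.Nat.GCD using (gcd; gcd[m,n]∣m; gcd[m,n]∣n)
open import Data.Integer using (ℤ; +_; 0ℤ; _+_; _-_; _*_; -_; _%ℕ_; _/ℕ_)
open import Data.Integer.Divisibility using (_∣_)
open import Data.Integer.Divisibility.Signed as Signed
  using (divides; ∣ᵤ⇒∣; ∣⇒∣ᵤ; ∣-trans; ∣m∣n⇒∣m+n; ∣m∣n⇒∣m-n; ∣n⇒∣m*n; ∣m⇒∣m*n)
open import Data.Integer.DivMod using (a≡a%ℕn+[a/ℕn]*n)
open import Data.Integer.Properties using (+-identityʳ)
open import Data.Integer.Tactic.RingSolver using (solve-∀)
open import Function using (_$_)
open import Data.Product using (_×_; Σ; _,_)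
open import Relation.Binary.PropositionalEquality using (_≡_; refl; cong; subst)
open Relation.Binary.PropositionalEquality.≡-Reasoning

infix 4 _≡_[mod_] _≈_[mod_]

-- A record rather than a synonym for g ∣ x - y, so that x and y can be inferred.
record _≡_[mod_] (x y g : ℤ) : Set where
  constructor ≡-mod
  field ∣difference : g Signed.∣ x - y

_≈_[mod_] : ℤ × ℤ → ℤ × ℤ → ℤ → Set
(x , y) ≈ (x′ , y′) [mod g ] = (x ≡ x′ [mod g ]) × (y ≡ y′ [mod g ])

≡-mod-weaken : ∀ {g h x y} → g Signed.∣ h → x ≡ y [mod h ] → x ≡ y [mod g ]
≡-mod-weaken g∣h (≡-mod h∣x-y) = ≡-mod (∣-trans g∣h h∣x-y)

≡-mod-0⇒∣ : ∀ {g x y} → x ≡ y [mod g ] → y ≡ 0ℤ → g Signed.∣ x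
≡-mod-0⇒∣ {g} {x} (≡-mod g∣x-0) refl = subst (g Signed.∣_) (+-identityʳ x) g∣x-0

+-cong-mod : ∀ {g x x′ y y′} → x ≡ x′ [mod g ] → y ≡ y′ [mod g ] → x + y ≡ x′ + y′ [mod g ]
+-cong-mod {g} {x} {x′} {y} {y′} (≡-mod g∣x-x′) (≡-mod g∣y-y′) =
  ≡-mod $ subst (g Signed.∣_) (regroup x x′ y y′) (∣m∣n⇒∣m+n g∣x-x′ g∣y-y′)
  where
  regroup : ∀ x x′ y y′ → (x - x′) + (y - y′) ≡ (x + y) - (x′ + y′)
  regroup = solve-∀

-‿cong-mod : ∀ {g x x′ y y′} → x ≡ x′ [mod g ] → y ≡ y′ [mod g ] → x - y ≡ x′ - y′ [mod g ]
-‿cong-mod {g} {x} {x′} {y} {y′} (≡-mod g∣x-x′) (≡-mod g∣y-y′) =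
  ≡-mod $ subst (g Signed.∣_) (regroup x x′ y y′) (∣m∣n⇒∣m-n g∣x-x′ g∣y-y′)
  where
  regroup : ∀ x x′ y y′ → (x - x′) - (y - y′) ≡ (x - y) - (x′ - y′)
  regroup = solve-∀

*-cong-mod : ∀ {g x x′ y y′} → x ≡ x′ [mod g ] → y ≡ y′ [mod g ] → x * y ≡ x′ * y′ [mod g ]
*-cong-mod {g} {x} {x′} {y} {y′} (≡-mod g∣x-x′) (≡-mod g∣y-y′) =
  ≡-mod $ subst (g Signed.∣_) (regroup x x′ y y′) (∣m∣n⇒∣m+n (∣m⇒∣m*n y g∣x-x′) (∣n⇒∣m*n x′ g∣y-y′))
  where
  regroup : ∀ x x′ y y′ → (x - x′) * y + x′ * (y - y′) ≡ x * y - x′ * y′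
  regroup = solve-∀

%ℕ-≡-mod : ∀ z m .{{_ : NonZero m}} → + (z %ℕ m) ≡ z [mod + m ]
%ℕ-≡-mod z m = ≡-mod $ divides (- (z /ℕ m)) (begin
  r - z           ≡⟨ cong (_-_ r) (a≡a%ℕn+[a/ℕn]*n z m) ⟩
  r - (r + q * d) ≡⟨ cancel r q d ⟩
  - q * d         ∎)
  where
  r = + (z %ℕ m)
  q = z /ℕ m
  d = + m
  cancel : ∀ r q d → r - (r + q * d) ≡ - q * d
  cancel = solve-∀

-- Written exactly as D, so that D a b c is definitionally det (toℤ² a) (toℤ² b) (toℤ² c).
det : ℤ × ℤ → ℤ × ℤ → ℤ × ℤ → ℤ
det (ax , ay) (bx , by) (cx , cy) =
  (bx * cy - cx * by) - (ax * cy - cx * ay) + (ax * by - bx * ay)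

toℤ² : Point → ℤ × ℤ
toℤ² (x , y) = (+ x , + y)

det-cong-mod : ∀ {g p p′ q q′ r r′} → p ≈ p′ [mod g ] → q ≈ q′ [mod g ] → r ≈ r′ [mod g ]
  → det p q r ≡ det p′ q′ r′ [mod g ]
det-cong-mod {p = _ , _} {_ , _} {_ , _} {_ , _} {_ , _} {_ , _}
             (px , py) (qx , qy) (rx , ry) =
  +-cong-mod (-‿cong-mod (-‿cong-mod (*-cong-mod qx ry) (*-cong-mod rx qy))
                         (-‿cong-mod (*-cong-mod px ry) (*-cong-mod rx py)))
             (-‿cong-mod (*-cong-mod px qy) (*-cong-mod qx py))

det-pointAt : ∀ L k₁ k₂ k₃ → det (pointAt L k₁) (pointAt L k₂) (pointAt L k₃) ≡ 0ℤ
det-pointAt (line a b u v _) = vanishes a b u v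
  where
  vanishes : ∀ a b u v k₁ k₂ k₃ →
    ((a + u * k₂) * (b + v * k₃) - (a + u * k₃) * (b + v * k₂))
    - ((a + u * k₁) * (b + v * k₃) - (a + u * k₃) * (b + v * k₁))
    + ((a + u * k₁) * (b + v * k₂) - (a + u * k₂) * (b + v * k₁)) ≡ 0ℤ
  vanishes = solve-∀

π-≈-mod : ∀ {g} m n .{{_ : NonZero m}} .{{_ : NonZero n}} → g Signed.∣ + m → g Signed.∣ + n
  → ∀ p → toℤ² (π m n p) ≈ p [mod g ]
π-≈-mod m n g∣m g∣n (x , y) = ≡-mod-weaken g∣m (%ℕ-≡-mod x m) , ≡-mod-weaken g∣n (%ℕ-≡-mod y n)

lemma3p2 : (m n : ℕ) → 1 < m → 1 < n → .{{_ : NonZero m}} → .{{_ : NonZero n}}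
    → (a b c : Point) → InTorus m n a → InTorus m n b → InTorus m n c
    → (Σ Line λ L → OnTorusLine m n L a × OnTorusLine m n L b × OnTorusLine m n L c)
    → (+ gcd m n) ∣ D a b c
lemma3p2 m n _ _ _ _ _ _ _ _ (L , (k₁ , refl) , (k₂ , refl) , (k₃ , refl)) =
  ∣⇒∣ᵤ (≡-mod-0⇒∣ (det-cong-mod (reduce k₁) (reduce k₂) (reduce k₃)) (det-pointAt L k₁ k₂ k₃))
  where
  reduce : ∀ k → toℤ² (π m n (pointAt L k)) ≈ pointAt L k [mod + gcd m n ]
  reduce k = π-≈-mod m n (∣ᵤ⇒∣ (gcd[m,n]∣m m n)) (∣ᵤ⇒∣ (gcd[m,n]∣n m n)) (pointAt L k)
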